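{- If $(a,b,c,r,s;x_1,y_1,\dots,x_N,y_N)$ is a set of solutions, then $\min(x_i,y_i)=0$ for at most two indices $i$, $1\le i\le N$, except when this set of solutions is in the same family as a subset (or an associate of a subset) of one of: $(3,3,2,1,1;0,0,0,1,1,0)$, $(5,2,3,1,2;0,0,0,1,1,0,1,2,3,6)$, $(2,2,5,1,3;0,1,1,0,3,0)$, $(2,2,3,1,1;0,1,0,2,1,0,2,0)$.
   Context: For integers $a>1$, $b>1$, $c>0$, $r>0$, $s>0$, a solution of $(-1)^u r a^x + (-1)^v s b^y = c$ is a quadruple $(x,y,u,v)$ with $x,y$ nonnegative integers and $u,v\in\{0,1\}$; it is referred to by the pair $(x,y)$, which determines $(u,v)$. A set of solutions $(a,b,c,r,s;x_1,y_1,\dots,x_N,y_N)$ is the unordered set of $N>2$ distinct pairs $(x_i,y_i)$, each a solution for the given $a,b,c,r,s$. Two sets of solutions $(a,b,c,r,s;x_1,y_1,\dots,x_N,y_N)$ and $(A,B,C,R,S;X_1,Y_1,\dots,X_N,Y_N)$ are in the same family if $a$ and $A$ are both powers of one integer, $b$ and $B$ are both powers of one integer, and there is a positive rational $k$ with $kc=C$ such that for every $i$ there is $j$ with $kra^{x_i}=RA^{X_j}$ and $ksb^{y_i}=SB^{Y_j}$. A subset of a set of solutions is any set of solutions (at least three pairs) with the same $a,b,c,r,s$ all of whose pairs are among the $(x_i,y_i)$ (possibly all of them). The associate of $(a,b,c,r,s;x_1,y_1,\dots,x_N,y_N)$ is $(b,a,c,s,r;y_1,x_1,\dots,y_N,x_N)$.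 -}

module Defs where

open import Data.Nat as ℕ using (ℕ; _>_; _≤_; _^_; _⊓_)
open import Data.Nat.Properties using () renaming (_≟_ to _≟ℕ_)
open import Data.Integer as ℤ using (ℤ; +_; -1ℤ)
open import Data.Rational as ℚ using (ℚ)
open import Data.Product using (Σ; ∃; _×_; _,_; proj₁; proj₂)
open import Data.Sum using (_⊎_)
open import Data.List using (List; []; _∷_; length; filter; map)
open import Data.List.Membership.Propositional using (_∈_)
open import Data.List.Relation.Unary.All using (All)
open import Data.List.Relation.Unary.Unique.Propositional using (Unique)
open import Relation.Binary.PropositionalEquality using (_≡_)

record Tuple : Set where
  constructor tuple
  field
    a b c r s : ℕ
    pairs : List (ℕ × ℕ)
open Tuple public

IsSolution : (a b c r s x y u v : ℕ) → Set
IsSolution a b c r s x y u v =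
  u ≤ 1 × v ≤ 1 ×
  (-1ℤ ℤ.^ u) ℤ.* (+ (r ℕ.* a ^ x)) ℤ.+ (-1ℤ ℤ.^ v) ℤ.* (+ (s ℕ.* b ^ y)) ≡ + c

IsSolutionPair : (a b c r s : ℕ) → ℕ × ℕ → Set
IsSolutionPair a b c r s (x , y) = ∃ λ u → ∃ λ v → IsSolution a b c r s x y u v

IsSetOfSolutions : Tuple → Set
IsSetOfSolutions T =
  a T > 1 × b T > 1 × c T > 0 × r T > 0 × s T > 0 ×
  Unique (pairs T) × length (pairs T) > 2 ×
  All (IsSolutionPair (a T) (b T) (c T) (r T) (s T)) (pairs T)

PowersOfOne : ℕ → ℕ → Set
PowersOfOne m n = ∃ λ g → ∃ λ i → ∃ λ j → m ≡ g ^ i × n ≡ g ^ j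

ℕ→ℚ : ℕ → ℚ
ℕ→ℚ n = + n ℚ./ 1

SameFamily : Tuple → Tuple → Set
SameFamily T U =
  length (pairs T) ≡ length (pairs U) ×
  PowersOfOne (a T) (a U) × PowersOfOne (b T) (b U) ×
  Σ ℚ λ k → ℚ.Positive k × k ℚ.* ℕ→ℚ (c T) ≡ ℕ→ℚ (c U) ×
    (∀ {p} → p ∈ pairs T → ∃ λ q → q ∈ pairs U ×
        k ℚ.* ℕ→ℚ (r T ℕ.* a T ^ proj₁ p) ≡ ℕ→ℚ (r U ℕ.* a U ^ proj₁ q) ×
        k ℚ.* ℕ→ℚ (s T ℕ.* b T ^ proj₂ p) ≡ ℕ→ℚ (s U ℕ.* b U ^ proj₂ q))

IsSubsetOf : Tuple → Tuple → Set
IsSubsetOf U T =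
  a U ≡ a T × b U ≡ b T × c U ≡ c T × r U ≡ r T × s U ≡ s T ×
  IsSetOfSolutions U ×
  (∀ {p} → p ∈ pairs U → p ∈ pairs T)

swap : ℕ × ℕ → ℕ × ℕ
swap (x , y) = (y , x)

associate : Tuple → Tuple
associate (tuple a b c r s ps) = tuple b a c s r (map swap ps)

exceptional : List Tuple
exceptional =
    tuple 3 3 2 1 1 ((0 , 0) ∷ (0 , 1) ∷ (1 , 0) ∷ [])
  ∷ tuple 5 2 3 1 2 ((0 , 0) ∷ (0 , 1) ∷ (1 , 0) ∷ (1 , 2) ∷ (3 , 6) ∷ [])
  ∷ tuple 2 2 5 1 3 ((0 , 1) ∷ (1 , 0) ∷ (3 , 0) ∷ [])
  ∷ tuple 2 2 3 1 1 ((0 , 1) ∷ (0 , 2) ∷ (1 , 0) ∷ (2 , 0) ∷ [])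
  ∷ []

IsExceptional : Tuple → Set
IsExceptional T = ∃ λ E → E ∈ exceptional × ∃ λ U → IsSubsetOf U E ×
  (SameFamily T U ⊎ SameFamily T (associate U))

numMinZero : Tuple → ℕ
numMinZero T = length (filter (λ p → (proj₁ p ⊓ proj₂ p) ≟ℕ 0) (pairs T))

{-# OPTIONS --safe #-}
-- Three pairs with a zero coordinate put two of them on one axis, say (0 , y) and (0 , y′), and the
-- third at (x , 0): for fixed A the equation ±A ± B = c has only the two roots B = c + A and
-- B = ∣ c - A ∣, so three points on one axis are impossible. Hence s b^y′ = c + r, s b^y = ∣ c - r ∣ and
-- r a^x ± s = c; with β = b^y, 1 + q = b^(y′ - y), 1 + α = a^x this forces β q α = 2 β + 2 or
-- β q α + 2 = 2 β, which have six solutions. Each makes the equation a multiple of one of the four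
-- exceptional equations, with the bases replaced by powers of theirs (up to exchanging the two sides).
-- The solutions of such an equation map into the solutions of the exceptional one, which are all
-- among the listed pairs; for (5,2,3,1,2) this needs 2^(1+y) = 3 + 5^x to have no solution with
-- y ≥ 7, a congruence argument modulo 641.
module Submission where

open import Defs
open import Data.Nat as ℕ
  using (ℕ; zero; suc; _+_; _*_; _^_; _%_; _≤_; _<_; _>_; _⊓_; ∣_-_∣; NonZero; >-nonZero; z≤n; s≤s; z<s; s<s)
open import Data.Nat.Properties
open import Data.Nat.DivMod using (m≡m%n+[m/n]*n; %-distribˡ-+; %-distribˡ-*; m%n<n; m*n%n≡0; [m+kn]%n≡m%n)
open import Data.Nat.Divisibility using (_∣_; ∣-refl; _∣?_; ∣m⇒∣m*n; ∣n⇒∣m*n; ∣m+n∣m⇒∣n)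
open import Data.Nat.Coprimality using (1-coprimeTo) renaming (sym to coprime-sym)
open import Data.Nat.Tactic.RingSolver using (solve-∀)
open import Data.Integer as ℤ using (ℤ; -1ℤ)
import Data.Integer.Properties as ℤ
import Data.Integer.Tactic.RingSolver as ℤ-Ring
open import Data.Rational as ℚ using (ℚ; mkℚ; 1/_)
import Data.Rational.Properties as ℚ
open import Data.Rational.Unnormalised as ℚᵘ using (mkℚᵘ)
import Data.Rational.Unnormalised.Properties as ℚᵘ
open import Data.Empty using (⊥; ⊥-elim)
open import Data.Product using (∃; _×_; _,_; _,′_; proj₁; proj₂)
import Data.Product as Product
open import Data.Product.Properties using (≡-dec)
open import Data.Sum using (_⊎_; inj₁; inj₂)
open import Data.List using (List; []; _∷_; length; filter; map)
open import Data.List.Properties using (length-map; map-∘; map-id)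
open import Data.List.Membership.Propositional using (_∈_)
open import Data.List.Membership.Propositional.Properties using (∈-map⁺; ∈-map⁻; ∈-filter⁻)
open import Data.List.Relation.Unary.Any using (here; there)
open import Data.List.Relation.Unary.All as All using (All; []; _∷_)
import Data.List.Relation.Unary.All.Properties as All
open import Data.List.Relation.Unary.AllPairs using (_∷_)
open import Data.List.Relation.Unary.Unique.Propositional using (Unique)
import Data.List.Relation.Unary.Unique.Propositional.Properties as Unique
open import Data.List.Relation.Unary.Unique.DecPropositional (≡-dec _≟_ _≟_) using (unique?)
import Data.List.Membership.DecPropositional as DecMembership
open import Relation.Nullary using (Dec; ¬_; yes; no)
open import Relation.Nullary.Decidable using (True; toWitness; from-no; ¬?; _→-dec_; _⊎-dec_)
open import Relation.Nullary.Negation using (contradiction)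
open import Relation.Unary using (Decidable)
open import Relation.Binary.PropositionalEquality
open import Relation.Binary.Definitions using (tri<; tri≈; tri>)

open DecMembership (≡-dec _≟_ _≟_) using (_∈?_)
private module Triples = DecMembership (≡-dec _≟_ (≡-dec _≟_ _≟_))

-- Powers and congruences

allUpTo-byDecision : ∀ {P : ℕ → Set} (P? : Decidable P) v → {True (allUpTo? P? v)} → ∀ {n} → n < v → P n
allUpTo-byDecision P? v {holds} = toWitness holds

n<m^n : ∀ {m} n → 1 < m → n < m ^ n
n<m^n zero    1<m = s≤s z≤n
n<m^n {m} (suc n) 1<m = begin-strict
  suc n       ≤⟨ n<m^n n 1<m ⟩
  m ^ n       <⟨ m<m*n (m ^ n) m 1<m ⟩
  m ^ n * m   ≡⟨ *-comm (m ^ n) m ⟩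
  m * m ^ n   ∎
  where
  open ≤-Reasoning
  instance _ : NonZero (m ^ n)
           _ = m^n≢0 m n {{>-nonZero (<-trans (s≤s z≤n) 1<m)}}

n≤m*k^n : ∀ {m k} n → 0 < m → 1 < k → n ≤ m * k ^ n
n≤m*k^n {m} {k} n 0<m 1<k = ≤-trans (<⇒≤ (n<m^n n 1<k)) (m≤n*m (k ^ n) m {{>-nonZero 0<m}})

m≤m^[1+n] : ∀ {m} n → 1 < m → m ≤ m ^ suc n
m≤m^[1+n] {m} n 1<m = m≤m*n m (m ^ n) {{m^n≢0 m n {{>-nonZero (<-trans (s≤s z≤n) 1<m)}}}}

m^[1+n]≡1+q : ∀ {m} n → 1 < m → ∃ λ q → 0 < q × m ^ suc n ≡ suc q
m^[1+n]≡1+q n 1<m with m≤n⇒∃[o]m+o≡n (≤-trans 1<m (m≤m^[1+n] n 1<m))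
... | q , 2+q≡m^[1+n] = suc q , s≤s z≤n , sym 2+q≡m^[1+n]

^-injectiveʳ : ∀ {m n o} → 1 < m → m ^ n ≡ m ^ o → n ≡ o
^-injectiveʳ {m} {n} {o} 1<m eq with <-cmp n o
... | tri< n<o _ _ = ⊥-elim (<⇒≢ (^-monoʳ-< m 1<m n<o) eq)
... | tri≈ _ n≡o _ = n≡o
... | tri> _ _ n>o = ⊥-elim (<⇒≢ (^-monoʳ-< m 1<m n>o) (sym eq))

^-cancelʳ-< : ∀ m {n o} .{{_ : NonZero m}} → m ^ n < m ^ o → n < o
^-cancelʳ-< m lt = ≰⇒> (λ o≤n → <⇒≱ lt (^-monoʳ-≤ m o≤n))

power-base-byDecision : ∀ N {G : ℕ → Set} (G? : Decidable G) →
  {True (allUpTo? (λ m → allUpTo? (λ n → (m ^ suc n ≟ N) →-dec G? m) (suc N)) (suc N))} →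
  ∀ {m n} → 1 < m → m ^ suc n ≡ N → G m
power-base-byDecision N G? {holds} {m} {n} 1<m m^[1+n]≡N =
  allUpTo-byDecision _ (suc N) {holds} (s≤s (≤-trans (m≤m^[1+n] n 1<m) (≤-reflexive m^[1+n]≡N)))
    (m<n⇒m≤1+n (≤-trans (n<m^n (suc n) 1<m) (≤-reflexive m^[1+n]≡N))) m^[1+n]≡N

module _ (M : ℕ) .{{_ : NonZero M}} where

  ^-%-one : ∀ {m} → m % M ≡ 1 % M → ∀ n → m ^ n % M ≡ 1 % M
  ^-%-one h zero = refl
  ^-%-one {m} h (suc n) = begin
    m * m ^ n % M                  ≡⟨ %-distribˡ-* m (m ^ n) M ⟩
    (m % M) * (m ^ n % M) % M      ≡⟨ cong₂ (λ u v → u * v % M) h (^-%-one h n) ⟩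
    (1 % M) * (1 % M) % M          ≡⟨ %-distribˡ-* 1 1 M ⟨
    1 % M                          ∎
    where open ≡-Reasoning

  ^-%-periodic : ∀ m k .{{_ : NonZero k}} → m ^ k % M ≡ 1 % M → ∀ n → m ^ n % M ≡ m ^ (n % k) % M
  ^-%-periodic m k h n = begin
    m ^ n % M                                        ≡⟨ cong (λ z → m ^ z % M) (m≡m%n+[m/n]*n n k) ⟩
    m ^ (n % k + n ℕ./ k * k) % M                    ≡⟨ cong (_% M) (^-distribˡ-+-* m (n % k) (n ℕ./ k * k)) ⟩
    m ^ (n % k) * m ^ (n ℕ./ k * k) % M              ≡⟨ cong (λ z → m ^ (n % k) * m ^ z % M) (*-comm (n ℕ./ k) k) ⟩
    m ^ (n % k) * m ^ (k * (n ℕ./ k)) % M            ≡⟨ cong (λ z → m ^ (n % k) * z % M) (^-*-assoc m k (n ℕ./ k)) ⟨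
    m ^ (n % k) * (m ^ k) ^ (n ℕ./ k) % M            ≡⟨ %-distribˡ-* (m ^ (n % k)) _ M ⟩
    (m ^ (n % k) % M) * ((m ^ k) ^ (n ℕ./ k) % M) % M ≡⟨ cong (λ z → (m ^ (n % k) % M) * z % M) (^-%-one h (n ℕ./ k)) ⟩
    (m ^ (n % k) % M) * (1 % M) % M                  ≡⟨ %-distribˡ-* (m ^ (n % k)) 1 M ⟨
    m ^ (n % k) * 1 % M                              ≡⟨ cong (_% M) (*-identityʳ _) ⟩
    m ^ (n % k) % M                                  ∎
    where open ≡-Reasoning

-- Modulo 2⁸, 3 + 5^m ≡ 0 forces m ≡ 35 (mod 64). The orders of 2 and 5 modulo 641 divide 64,
-- and 3 + 5³⁵ is not congruent to a power of 2 modulo 641.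
256*2^n≢3+5^m : ∀ n m → 256 * 2 ^ n ≢ 3 + 5 ^ m
256*2^n≢3+5^m n m eq =
  allUpTo-byDecision (λ j → ¬? (2 ^ j % 641 ≟ residue)) 64 (m%n<n (8 + n) 64) (begin
    2 ^ ((8 + n) % 64) % 641        ≡⟨ ^-%-periodic 641 2 64 refl (8 + n) ⟨
    2 ^ (8 + n) % 641               ≡⟨ cong (_% 641) (trans (^-distribˡ-+-* 2 8 n) eq) ⟩
    (3 + 5 ^ m) % 641               ≡⟨ %-distribˡ-+ 3 (5 ^ m) 641 ⟩
    (3 + 5 ^ m % 641) % 641         ≡⟨ cong (λ z → (3 + z) % 641) (^-%-periodic 641 5 64 refl m) ⟩
    (3 + 5 ^ (m % 64) % 641) % 641  ≡⟨ cong (λ z → (3 + 5 ^ z % 641) % 641) m%64≡35 ⟩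
    residue                         ∎)
  where
  open ≡-Reasoning
  residue : ℕ
  residue = (3 + 5 ^ 35 % 641) % 641
  m%64≡35 : m % 64 ≡ 35
  m%64≡35 = allUpTo-byDecision (λ i → (3 + 5 ^ i % 256) % 256 ≟ 0 →-dec i ≟ 35) 64 (m%n<n m 64) (begin
    (3 + 5 ^ (m % 64) % 256) % 256  ≡⟨ cong (λ z → (3 + z) % 256) (^-%-periodic 256 5 64 refl m) ⟨
    (3 + 5 ^ m % 256) % 256         ≡⟨ %-distribˡ-+ 3 (5 ^ m) 256 ⟨
    (3 + 5 ^ m) % 256               ≡⟨ cong (_% 256) (trans (sym eq) (*-comm 256 (2 ^ n))) ⟩
    2 ^ n * 256 % 256               ≡⟨ m*n%n≡0 (2 ^ n) 256 ⟩
    0                               ∎)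

-- 5^x ≡ 1 and 3 + 2^(2+y) ≡ 3 modulo 4.
5^x≢3+4*2^y : ∀ x y → 1 * 5 ^ x ≢ 3 + 2 * 2 ^ suc y
5^x≢3+4*2^y x y eq = contradiction (begin
  1                          ≡⟨ ^-%-one 4 refl x ⟨
  5 ^ x % 4                  ≡⟨ cong (_% 4) (trans (sym (*-identityˡ (5 ^ x))) eq) ⟩
  (3 + 2 * 2 ^ suc y) % 4    ≡⟨ cong (λ n → (3 + n) % 4) (2*[2*n]≡n*4 (2 ^ y)) ⟩
  (3 + 2 ^ y * 4) % 4        ≡⟨ [m+kn]%n≡m%n 3 (2 ^ y) 4 ⟩
  3                          ∎) λ ()
  where
  open ≡-Reasoning
  2*[2*n]≡n*4 : ∀ n → 2 * (2 * n) ≡ n * 4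
  2*[2*n]≡n*4 = solve-∀

-- Signed sums

-- The sign patterns of ±A ± B = c for c > 0 (−A − B = c is impossible), grouped by the root B:
-- either B = c + A or B = ∣ c - A ∣.
SmallRoot : ℕ → ℕ → ℕ → Set
SmallRoot c A B = A + B ≡ c ⊎ A ≡ c + B

SignedSum : ℕ → ℕ → ℕ → Set
SignedSum c A B = B ≡ c + A ⊎ SmallRoot c A B

signedSum? : ∀ c A B → Dec (SignedSum c A B)
signedSum? c A B = (B ≟ c + A) ⊎-dec ((A + B ≟ c) ⊎-dec (A ≟ c + B))

signedSum-comm : ∀ {c A B} → SignedSum c A B → SignedSum c B A
signedSum-comm (inj₁ B≡c+A)                    = inj₂ (inj₂ B≡c+A)
signedSum-comm {A = A} {B} (inj₂ (inj₁ A+B≡c)) = inj₂ (inj₁ (trans (+-comm B A) A+B≡c))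
signedSum-comm (inj₂ (inj₂ A≡c+B))             = inj₁ A≡c+B

signedSum-cong : ∀ {c c′ A A′ B B′} → c ≡ c′ → A ≡ A′ → B ≡ B′ → SignedSum c A B → SignedSum c′ A′ B′
signedSum-cong refl refl refl sum = sum

signedSum-*-cancelˡ : ∀ {m c A B} .{{_ : NonZero m}} → SignedSum (m * c) (m * A) (m * B) → SignedSum c A B
signedSum-*-cancelˡ {m} {c} {A} {B} (inj₁ eq) =
  inj₁ (*-cancelˡ-≡ B (c + A) m (trans eq (sym (*-distribˡ-+ m c A))))
signedSum-*-cancelˡ {m} {c} {A} {B} (inj₂ (inj₁ eq)) =
  inj₂ (inj₁ (*-cancelˡ-≡ (A + B) c m (trans (*-distribˡ-+ m A B) eq)))
signedSum-*-cancelˡ {m} {c} {A} {B} (inj₂ (inj₂ eq)) =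
  inj₂ (inj₂ (*-cancelˡ-≡ A (c + B) m (trans eq (sym (*-distribˡ-+ m c B)))))

smallRoot⇒≡∣-∣ : ∀ {c A B} → SmallRoot c A B → B ≡ ∣ c - A ∣
smallRoot⇒≡∣-∣ {A = A} {B} (inj₁ refl) = sym (trans (∣-∣-comm (A + B) A) (∣m-m+n∣≡n A B))
smallRoot⇒≡∣-∣ {c} {B = B} (inj₂ refl) = sym (∣m-m+n∣≡n c B)

smallRoot-unique : ∀ {c A B B′} → SmallRoot c A B → SmallRoot c A B′ → B ≡ B′
smallRoot-unique small small′ = trans (smallRoot⇒≡∣-∣ small) (sym (smallRoot⇒≡∣-∣ small′))

smallRoot-< : ∀ {c A B} → 0 < c → 0 < A → SmallRoot c A B → B < c + A
smallRoot-< {c} {A} {B} _   0<A (inj₁ A+B≡c) =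
  <-≤-trans (m<n+m B 0<A) (≤-trans (≤-reflexive A+B≡c) (m≤m+n c A))
smallRoot-< {c} {A} {B} 0<c _   (inj₂ A≡c+B) =
  <-≤-trans (m<n+m B 0<c) (≤-trans (≤-reflexive (sym A≡c+B)) (m≤n+m A c))

two-roots : ∀ {c A B B′} → B ≢ B′ → SignedSum c A B → SignedSum c A B′ →
            (B ≡ c + A × SmallRoot c A B′) ⊎ (B′ ≡ c + A × SmallRoot c A B)
two-roots B≢B′ (inj₁ B≡c+A) (inj₁ B′≡c+A) = ⊥-elim (B≢B′ (trans B≡c+A (sym B′≡c+A)))
two-roots _    (inj₁ B≡c+A) (inj₂ small′)  = inj₁ (B≡c+A , small′)
two-roots _    (inj₂ small) (inj₁ B′≡c+A)  = inj₂ (B′≡c+A , small)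
two-roots B≢B′ (inj₂ small) (inj₂ small′)  = ⊥-elim (B≢B′ (smallRoot-unique small small′))

no-three-roots : ∀ {c A B₁ B₂ B₃} → B₁ ≢ B₂ → B₁ ≢ B₃ → B₂ ≢ B₃ →
                 SignedSum c A B₁ → SignedSum c A B₂ → SignedSum c A B₃ → ⊥
no-three-roots B₁≢B₂ B₁≢B₃ B₂≢B₃ root₁ root₂ root₃ with two-roots B₁≢B₂ root₁ root₂ | root₃
... | inj₁ (B₁≡c+A , _) | inj₁ B₃≡c+A = B₁≢B₃ (trans B₁≡c+A (sym B₃≡c+A))
... | inj₁ (_ , small₂) | inj₂ small₃ = B₂≢B₃ (smallRoot-unique small₂ small₃)
... | inj₂ (B₂≡c+A , _) | inj₁ B₃≡c+A = B₂≢B₃ (trans B₂≡c+A (sym B₃≡c+A))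
... | inj₂ (_ , small₁) | inj₂ small₃ = B₁≢B₃ (smallRoot-unique small₁ small₃)

isSolution⇒signedSum : ∀ {a b c r s x y u v} → 0 < c → IsSolution a b c r s x y u v →
                       SignedSum c (r * a ^ x) (s * b ^ y)
isSolution⇒signedSum {a} {b} {c} {r} {s} {x} {y} 0<c (u≤1 , v≤1 , eq) = signs u≤1 v≤1 eq
  where
  open import Data.Integer using (+_)
  A B : ℕ
  A = r * a ^ x
  B = s * b ^ y
  open ≡-Reasoning
  signs : ∀ {u v} → u ≤ 1 → v ≤ 1 → (-1ℤ ℤ.^ u) ℤ.* + A ℤ.+ (-1ℤ ℤ.^ v) ℤ.* + B ≡ + c → SignedSum c A B
  signs z≤n z≤n eq = inj₂ (inj₁ (ℤ.+-injective (begin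
    + (A + B)                                         ≡⟨ ℤ.pos-+ A B ⟩
    + A ℤ.+ + B                                       ≡⟨ regroup (+ A) (+ B) ⟩
    (-1ℤ ℤ.^ 0) ℤ.* + A ℤ.+ (-1ℤ ℤ.^ 0) ℤ.* + B       ≡⟨ eq ⟩
    + c                                               ∎)))
    where
    regroup : ∀ X Y → X ℤ.+ Y ≡ (-1ℤ ℤ.^ 0) ℤ.* X ℤ.+ (-1ℤ ℤ.^ 0) ℤ.* Y
    regroup = ℤ-Ring.solve-∀
  signs (s≤s z≤n) z≤n eq = inj₁ (ℤ.+-injective (begin
    + B                                                        ≡⟨ regroup (+ A) (+ B) ⟩
    ((-1ℤ ℤ.^ 1) ℤ.* + A ℤ.+ (-1ℤ ℤ.^ 0) ℤ.* + B) ℤ.+ + A      ≡⟨ cong (ℤ._+ + A) eq ⟩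
    + c ℤ.+ + A                                                ≡⟨ ℤ.pos-+ c A ⟨
    + (c + A)                                                  ∎))
    where
    regroup : ∀ X Y → Y ≡ ((-1ℤ ℤ.^ 1) ℤ.* X ℤ.+ (-1ℤ ℤ.^ 0) ℤ.* Y) ℤ.+ X
    regroup = ℤ-Ring.solve-∀
  signs z≤n (s≤s z≤n) eq = inj₂ (inj₂ (ℤ.+-injective (begin
    + A                                                        ≡⟨ regroup (+ A) (+ B) ⟩
    ((-1ℤ ℤ.^ 0) ℤ.* + A ℤ.+ (-1ℤ ℤ.^ 1) ℤ.* + B) ℤ.+ + B      ≡⟨ cong (ℤ._+ + B) eq ⟩
    + c ℤ.+ + B                                                ≡⟨ ℤ.pos-+ c B ⟨
    + (c + B)                                                  ∎)))
    where
    regroup : ∀ X Y → X ≡ ((-1ℤ ℤ.^ 0) ℤ.* X ℤ.+ (-1ℤ ℤ.^ 1) ℤ.* Y) ℤ.+ Y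
    regroup = ℤ-Ring.solve-∀
  signs (s≤s z≤n) (s≤s z≤n) eq = contradiction (m+n≡0⇒m≡0 c (ℤ.+-injective (begin
    + (c + (A + B))                                                 ≡⟨ ℤ.pos-+ c (A + B) ⟩
    + c ℤ.+ + (A + B)                                               ≡⟨ cong₂ ℤ._+_ (sym eq) (ℤ.pos-+ A B) ⟩
    ((-1ℤ ℤ.^ 1) ℤ.* + A ℤ.+ (-1ℤ ℤ.^ 1) ℤ.* + B) ℤ.+ (+ A ℤ.+ + B) ≡⟨ regroup (+ A) (+ B) ⟩
    + 0                                                             ∎))) (≢-sym (<⇒≢ 0<c))
    where
    regroup : ∀ X Y → ((-1ℤ ℤ.^ 1) ℤ.* X ℤ.+ (-1ℤ ℤ.^ 1) ℤ.* Y) ℤ.+ (X ℤ.+ Y) ≡ ℤ.0ℤ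
    regroup = ℤ-Ring.solve-∀

-- Three solutions on the axes

β*q*α≡2β+2-solutions : List (ℕ × ℕ × ℕ)
β*q*α≡2β+2-solutions = (1 , 1 , 4) ∷ (1 , 2 , 2) ∷ (1 , 4 , 1) ∷ (2 , 1 , 3) ∷ (2 , 3 , 1) ∷ []

β*q*α≡2β+2⇒∈ : ∀ {β q α} → 0 < β → 0 < q → 0 < α → β * q * α ≡ β + β + 2 →
                (β , q , α) ∈ β*q*α≡2β+2-solutions
β*q*α≡2β+2⇒∈ {β} {q} {α} 0<β 0<q 0<α eq =
  allUpTo-byDecision (λ β → allUpTo? (λ q → allUpTo? (λ α →
              (β * q * α ≟ β + β + 2) →-dec ((β , q , α) Triples.∈? β*q*α≡2β+2-solutions)) 7) 7) 3
    β<3 q<7 α<7 eq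
  where
  open ≤-Reasoning
  eq′ : β * (q * α) ≡ β + β + 2
  eq′ = trans (sym (*-assoc β q α)) eq
  3≤q*α : 3 ≤ q * α
  3≤q*α with 3 ≤? q * α
  ... | yes 3≤qα = 3≤qα
  ... | no  3≰qα = contradiction (begin
        β + β + 2    ≡⟨ eq′ ⟨
        β * (q * α)  ≤⟨ *-monoʳ-≤ β (≤-pred (≰⇒> 3≰qα)) ⟩
        β * 2        ≡⟨ *-comm β 2 ⟩
        β + (β + 0)  ≡⟨ cong (β +_) (+-identityʳ β) ⟩
        β + β        ∎) (m+1+n≰m (β + β))
  β<3 : β < 3
  β<3 = +-cancelˡ-≤ (β + β) (suc β) 3 (begin
        β + β + suc β         ≡⟨ +-suc (β + β) β ⟩
        suc (β + β + β)       ≡⟨ cong suc (β+β+β≡β*3 β) ⟩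
        suc (β * 3)           ≤⟨ s≤s (*-monoʳ-≤ β 3≤q*α) ⟩
        suc (β * (q * α))     ≡⟨ cong suc eq′ ⟩
        suc (β + β + 2)       ≡⟨ +-suc (β + β) 2 ⟨
        β + β + 3             ∎)
    where
    β+β+β≡β*3 : ∀ β → β + β + β ≡ β * 3
    β+β+β≡β*3 = solve-∀
  q*α≤6 : q * α ≤ 6
  q*α≤6 = begin
        q * α ≤⟨ m≤n*m (q * α) β {{>-nonZero 0<β}} ⟩
        β * (q * α) ≡⟨ eq′ ⟩
        β + β + 2 ≤⟨ +-monoˡ-≤ 2 (+-mono-≤ (≤-pred β<3) (≤-pred β<3)) ⟩
        6 ∎
  q<7 : q < 7
  q<7 = s≤s (≤-trans (m≤m*n q α {{>-nonZero 0<α}}) q*α≤6)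
  α<7 : α < 7
  α<7 = s≤s (≤-trans (m≤n*m α q {{>-nonZero 0<q}}) q*α≤6)

β*q*α+2≡2β⇒ : ∀ {β q α} → 0 < q → 0 < α → β * q * α + 2 ≡ β + β → β ≡ 2 × q ≡ 1 × α ≡ 1
β*q*α+2≡2β⇒ {β} {q} {α} 0<q 0<α eq = β≡2 , m*n≡1⇒m≡1 q α q*α≡1 , m*n≡1⇒n≡1 q α q*α≡1
  where
  open ≤-Reasoning
  eq′ : β * (q * α) + 2 ≡ β + β
  eq′ = trans (cong (_+ 2) (sym (*-assoc β q α))) eq
  q*α≡1 : q * α ≡ 1
  q*α≡1 with q * α ≤? 1
  ... | yes qα≤1 = ≤-antisym qα≤1 (*-mono-≤ 0<q 0<α)
  ... | no  qα≰1 = contradiction (begin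
        β + β + 2          ≡⟨ cong (_+ 2) (β*2≡β+β β) ⟨
        β * 2 + 2          ≤⟨ +-monoˡ-≤ 2 (*-monoʳ-≤ β (≰⇒> qα≰1)) ⟩
        β * (q * α) + 2    ≡⟨ eq′ ⟩
        β + β              ∎) (m+1+n≰m (β + β))
    where
    β*2≡β+β : ∀ β → β * 2 ≡ β + β
    β*2≡β+β = solve-∀
  β≡2 : β ≡ 2
  β≡2 = sym (+-cancelˡ-≡ β 2 β (begin-equality
        β + 2              ≡⟨ cong (λ n → n + 2) (*-identityʳ β) ⟨
        β * 1 + 2          ≡⟨ cong (λ n → β * n + 2) q*α≡1 ⟨
        β * (q * α) + 2    ≡⟨ eq′ ⟩
        β + β              ∎))

-- β = b^y, 1 + q = b^(y′ - y) and 1 + α = a^x for the three solutions (0 , y), (0 , y′), (x , 0);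
-- each outcome is named after (a^x , b^(y′ - y)).
data Outcome (β q α c r s : ℕ) : Set where
  five-two    : β ≡ 1 → q ≡ 1 → α ≡ 4 → c ≡ r * 3 → s ≡ r * 2 → Outcome β q α c r s
  three-three : β ≡ 1 → q ≡ 2 → α ≡ 2 → c ≡ s * 2 → r ≡ s * 1 → Outcome β q α c r s
  two-five    : β ≡ 1 → q ≡ 4 → α ≡ 1 → c ≡ s * 3 → r ≡ s * 2 → Outcome β q α c r s
  four-two    : β ≡ 2 → q ≡ 1 → α ≡ 3 → c ≡ s * 3 → r ≡ s * 1 → Outcome β q α c r s
  two-four    : β ≡ 2 → q ≡ 3 → α ≡ 1 → c ≡ s * 5 → r ≡ s * 3 → Outcome β q α c r s
  two-two     : β ≡ 2 → q ≡ 1 → α ≡ 1 → c ≡ s * 3 → r ≡ s * 1 → Outcome β q α c r s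

m+m≡n+n⇒m≡n : ∀ {m n} → m + m ≡ n + n → m ≡ n
m+m≡n+n⇒m≡n {m} {n} eq = *-cancelʳ-≡ m n 2 (begin-equality
  m * 2    ≡⟨ k*2≡k+k m ⟩
  m + m    ≡⟨ eq ⟩
  n + n    ≡⟨ k*2≡k+k n ⟨
  n * 2    ∎)
  where
  open ≤-Reasoning
  k*2≡k+k : ∀ k → k * 2 ≡ k + k
  k*2≡k+k = solve-∀

r≡s*ρ : ∀ s {β q r} ρ → β * q ≡ ρ + ρ → s * β * q ≡ r + r → r ≡ s * ρ
r≡s*ρ s {β} {q} {r} ρ β*q≡ρ+ρ s*β*q≡r+r = m+m≡n+n⇒m≡n (begin
  r + r           ≡⟨ s*β*q≡r+r ⟨
  s * β * q       ≡⟨ *-assoc s β q ⟩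
  s * (β * q)     ≡⟨ cong (s *_) β*q≡ρ+ρ ⟩
  s * (ρ + ρ)     ≡⟨ *-distribˡ-+ s ρ ρ ⟩
  s * ρ + s * ρ   ∎)
  where open ≡-Reasoning

c≡s*[ρ+β] : ∀ s β ρ {r c} → r ≡ s * ρ → r + s * β ≡ c → c ≡ s * (ρ + β)
c≡s*[ρ+β] s β ρ {r} {c} r≡s*ρ r+s*β≡c = begin
  c               ≡⟨ r+s*β≡c ⟨
  r + s * β       ≡⟨ cong (_+ s * β) r≡s*ρ ⟩
  s * ρ + s * β   ≡⟨ *-distribˡ-+ s ρ β ⟨
  s * (ρ + β)     ∎
  where open ≡-Reasoning

difference-outcome : ∀ {β q α c r} s → (β , q , α) ∈ β*q*α≡2β+2-solutions →
                     s * β * q ≡ r + r → r + s * β ≡ c → Outcome β q α c r s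
difference-outcome {c = c} {r} s (here refl) s*β*q≡r+r r+s*β≡c = five-two refl refl refl c≡r*3 s≡r*2
  where
  s≡r*2 : s ≡ r * 2
  s≡r*2 = trans (sym (s*1*1≡s s)) (trans s*β*q≡r+r (r+r≡r*2 r))
    where
    s*1*1≡s : ∀ s → s * 1 * 1 ≡ s
    s*1*1≡s = solve-∀
    r+r≡r*2 : ∀ r → r + r ≡ r * 2
    r+r≡r*2 = solve-∀
  c≡r*3 : c ≡ r * 3
  c≡r*3 = trans (sym r+s*β≡c) (trans (cong (λ n → r + n * 1) s≡r*2) (r+r*2*1≡r*3 r))
    where
    r+r*2*1≡r*3 : ∀ r → r + r * 2 * 1 ≡ r * 3
    r+r*2*1≡r*3 = solve-∀
difference-outcome {r = r} s (there (here refl)) s*β*q≡r+r r+s*β≡c =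
  three-three refl refl refl (c≡s*[ρ+β] s 1 1 r≡s r+s*β≡c) r≡s
  where r≡s : r ≡ s * 1
        r≡s = r≡s*ρ s 1 refl s*β*q≡r+r
difference-outcome {r = r} s (there (there (here refl))) s*β*q≡r+r r+s*β≡c =
  two-five refl refl refl (c≡s*[ρ+β] s 1 2 r≡2s r+s*β≡c) r≡2s
  where r≡2s : r ≡ s * 2
        r≡2s = r≡s*ρ s 2 refl s*β*q≡r+r
difference-outcome {r = r} s (there (there (there (here refl)))) s*β*q≡r+r r+s*β≡c =
  four-two refl refl refl (c≡s*[ρ+β] s 2 1 r≡s r+s*β≡c) r≡s
  where r≡s : r ≡ s * 1
        r≡s = r≡s*ρ s 1 refl s*β*q≡r+r
difference-outcome {r = r} s (there (there (there (there (here refl))))) s*β*q≡r+r r+s*β≡c =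
  two-four refl refl refl (c≡s*[ρ+β] s 2 3 r≡3s r+s*β≡c) r≡3s
  where r≡3s : r ≡ s * 3
        r≡3s = r≡s*ρ s 3 refl s*β*q≡r+r

module AxisArithmetic {β q α c r s : ℕ} (0<β : 0 < β) (0<q : 0 < q) (0<α : 0 < α) (0<c : 0 < c) (0<r : 0 < r)
                          (0<s : 0 < s) (high : s * β * suc q ≡ c + r) where
  open ≤-Reasoning

  private
    s≤s*β : s ≤ s * β
    s≤s*β = m≤m*n s β {{>-nonZero 0<β}}
    r≤r*[1+α] : r ≤ r * suc α
    r≤r*[1+α] = m≤m*n r (suc α)
    0<r*α : 0 < r * α
    0<r*α = *-mono-≤ 0<r 0<α

  ¬r≡c+s*β : r ≡ c + s * β → ¬ SignedSum c (r * suc α) s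
  ¬r≡c+s*β r≡c+sβ (inj₁ s≡c+rα) = <-irrefl refl (begin-strict
    s               ≤⟨ s≤s*β ⟩
    s * β           ≤⟨ m≤n+m (s * β) c ⟩
    c + s * β       ≡⟨ r≡c+sβ ⟨
    r               ≤⟨ r≤r*[1+α] ⟩
    r * suc α       <⟨ m<n+m (r * suc α) 0<c ⟩
    c + r * suc α   ≡⟨ s≡c+rα ⟨
    s               ∎)
  ¬r≡c+s*β r≡c+sβ (inj₂ (inj₁ rα+s≡c)) = <-irrefl refl (begin-strict
    c               <⟨ m<m+n c (*-mono-≤ 0<s 0<β) ⟩
    c + s * β       ≡⟨ r≡c+sβ ⟨
    r               ≤⟨ r≤r*[1+α] ⟩
    r * suc α       ≤⟨ m≤m+n (r * suc α) s ⟩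
    r * suc α + s   ≡⟨ rα+s≡c ⟩
    c               ∎)
  ¬r≡c+s*β r≡c+sβ (inj₂ (inj₂ rα≡c+s)) = <-irrefl refl (begin-strict
    c + s                   ≤⟨ +-monoʳ-≤ c s≤s*β ⟩
    c + s * β               <⟨ m<m+n (c + s * β) 0<r*α ⟩
    c + s * β + r * α       ≡⟨ cong (_+ r * α) r≡c+sβ ⟨
    r + r * α               ≡⟨ *-suc r α ⟨
    r * suc α               ≡⟨ rα≡c+s ⟩
    c + s                   ∎)

  module _ (r+s*β≡c : r + s * β ≡ c) where

    s*β*q≡r+r : s * β * q ≡ r + r
    s*β*q≡r+r = +-cancelˡ-≡ (s * β) (s * β * q) (r + r) (begin-equality
      s * β + s * β * q    ≡⟨ *-suc (s * β) q ⟨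
      s * β * suc q        ≡⟨ high ⟩
      c + r                ≡⟨ cong (_+ r) r+s*β≡c ⟨
      r + s * β + r        ≡⟨ regroup r (s * β) ⟩
      s * β + (r + r)      ∎)
      where
      regroup : ∀ r t → r + t + r ≡ t + (r + r)
      regroup = solve-∀

    ¬s≡c+r*[1+α] : ¬ s ≡ c + r * suc α
    ¬s≡c+r*[1+α] s≡c+rα = <-irrefl refl (begin-strict
      s               ≤⟨ s≤s*β ⟩
      s * β           <⟨ m<n+m (s * β) 0<r ⟩
      r + s * β       ≡⟨ r+s*β≡c ⟩
      c               ≤⟨ m≤m+n c (r * suc α) ⟩
      c + r * suc α   ≡⟨ s≡c+rα ⟨
      s               ∎)

    -- Multiplying by s β q = r + r eliminates r and c; cancelling s leaves an equation in β, q, α.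
    sum-case : r * suc α + s ≡ c → β * q * α + 2 ≡ β + β
    sum-case rα+s≡c = *-cancelˡ-≡ _ _ s {{>-nonZero 0<s}} (begin-equality
      s * (β * q * α + 2)            ≡⟨ expand s β q α ⟩
      s * β * q * α + (s + s)        ≡⟨ cong (λ n → n * α + (s + s)) s*β*q≡r+r ⟩
      (r + r) * α + (s + s)          ≡⟨ regroup r α s ⟩
      (r * α + s) + (r * α + s)      ≡⟨ cong₂ _+_ r*α+s≡s*β r*α+s≡s*β ⟩
      s * β + s * β                  ≡⟨ *-distribˡ-+ s β β ⟨
      s * (β + β)                    ∎)
      where
      expand : ∀ s β q α → s * (β * q * α + 2) ≡ s * β * q * α + (s + s)
      expand = solve-∀
      regroup : ∀ r α s → (r + r) * α + (s + s) ≡ (r * α + s) + (r * α + s)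
      regroup = solve-∀
      r*α+s≡s*β : r * α + s ≡ s * β
      r*α+s≡s*β = +-cancelˡ-≡ r _ _ (begin-equality
        r + (r * α + s)   ≡⟨ +-assoc r (r * α) s ⟨
        r + r * α + s     ≡⟨ cong (_+ s) (*-suc r α) ⟨
        r * suc α + s     ≡⟨ rα+s≡c ⟩
        c                 ≡⟨ r+s*β≡c ⟨
        r + s * β         ∎)

    difference-case : r * suc α ≡ c + s → β * q * α ≡ β + β + 2
    difference-case rα≡c+s = *-cancelˡ-≡ _ _ s {{>-nonZero 0<s}} (begin-equality
      s * (β * q * α)               ≡⟨ expand s β q α ⟩
      s * β * q * α                 ≡⟨ cong (_* α) s*β*q≡r+r ⟩
      (r + r) * α                   ≡⟨ *-distribʳ-+ α r r ⟩
      r * α + r * α                 ≡⟨ cong₂ _+_ r*α≡s*β+s r*α≡s*β+s ⟩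
      (s * β + s) + (s * β + s)     ≡⟨ regroup s β ⟩
      s * (β + β + 2)               ∎)
      where
      expand : ∀ s β q α → s * (β * q * α) ≡ s * β * q * α
      expand = solve-∀
      regroup : ∀ s β → (s * β + s) + (s * β + s) ≡ s * (β + β + 2)
      regroup = solve-∀
      r*α≡s*β+s : r * α ≡ s * β + s
      r*α≡s*β+s = +-cancelˡ-≡ r _ _ (begin-equality
        r + r * α         ≡⟨ *-suc r α ⟨
        r * suc α         ≡⟨ rα≡c+s ⟩
        c + s             ≡⟨ cong (_+ s) r+s*β≡c ⟨
        r + s * β + s     ≡⟨ +-assoc r (s * β) s ⟩
        r + (s * β + s)   ∎)

  outcome : SmallRoot c r (s * β) → SignedSum c (r * suc α) s → Outcome β q α c r s
  outcome (inj₂ r≡c+s*β) third = contradiction third (¬r≡c+s*β r≡c+s*β)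
  outcome (inj₁ r+s*β≡c) (inj₁ s≡c+rα) = contradiction s≡c+rα (¬s≡c+r*[1+α] r+s*β≡c)
  outcome (inj₁ r+s*β≡c) (inj₂ (inj₁ rα+s≡c)) with β*q*α+2≡2β⇒ {β} {q} {α} 0<q 0<α (sum-case r+s*β≡c rα+s≡c)
  ... | refl , refl , refl = two-two refl refl refl (c≡s*[ρ+β] s β _ r≡s r+s*β≡c) r≡s
    where r≡s : r ≡ s * 1
          r≡s = r≡s*ρ s 1 refl (s*β*q≡r+r r+s*β≡c)
  outcome (inj₁ r+s*β≡c) (inj₂ (inj₂ rα≡c+s)) =
    difference-outcome s (β*q*α≡2β+2⇒∈ 0<β 0<q 0<α (difference-case r+s*β≡c rα≡c+s))
                       (s*β*q≡r+r r+s*β≡c) r+s*β≡c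

Solution : Tuple → ℕ × ℕ → Set
Solution T (x , y) = SignedSum (c T) (r T * a T ^ x) (s T * b T ^ y)

setOfSolutions⇒solution : ∀ {T p} → IsSetOfSolutions T → p ∈ pairs T → Solution T p
setOfSolutions⇒solution {T} {x , y} (_ , _ , 0<c , _ , _ , _ , _ , solutions) p∈ with All.lookup solutions p∈
... | _ , _ , solution = isSolution⇒signedSum {a T} {b T} {c T} {r T} {s T} {x} {y} 0<c solution

OnAxis : ℕ × ℕ → Set
OnAxis (x , y) = x ≡ 0 ⊎ y ≡ 0

-- Rescalings of the exceptional equations

-- The equation with parameters (a′, b′, c′, r′, s′) is m times that of E with bases a E ^ k and b E ^ l,
-- so each of its solutions (x , y) gives the solution (k x , l y) of E.
record IsRescalingOf (a′ b′ c′ r′ s′ : ℕ) (E : Tuple) : Set where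
  field
    k l m : ℕ
    0<k : 0 < k
    0<l : 0 < l
    0<m : 0 < m
    a≡ : a′ ≡ a E ^ k
    b≡ : b′ ≡ b E ^ l
    c≡ : c′ ≡ m * c E
    r≡ : r′ ≡ m * r E
    s≡ : s′ ≡ m * s E

RescalesExceptional : Tuple → Set
RescalesExceptional (tuple a b c r s _) =
  ∃ λ E → E ∈ exceptional × (IsRescalingOf a b c r s E ⊎ IsRescalingOf b a c s r E)

rescalesExceptional-associate : ∀ {T} → RescalesExceptional (associate T) → RescalesExceptional T
rescalesExceptional-associate (E , E∈ , inj₁ rescaling) = E , E∈ , inj₂ rescaling
rescalesExceptional-associate (E , E∈ , inj₂ rescaling) = E , E∈ , inj₁ rescaling

multiple⇒rescaling : ∀ {A B C R S E} m → 0 < m → A ≡ a E → B ≡ b E →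
                     C ≡ m * c E → R ≡ m * r E → S ≡ m * s E → IsRescalingOf A B C R S E
multiple⇒rescaling {E = E} m 0<m A≡ B≡ C≡ R≡ S≡ = record
  { k = 1 ; l = 1 ; m = m ; 0<k = z<s ; 0<l = z<s ; 0<m = 0<m
  ; a≡ = trans A≡ (sym (*-identityʳ (a E))) ; b≡ = trans B≡ (sym (*-identityʳ (b E)))
  ; c≡ = C≡ ; r≡ = R≡ ; s≡ = S≡ }

m^[1+n]≡2⇒m≡2 : ∀ {m} n → 1 < m → m ^ suc n ≡ 2 → m ≡ 2
m^[1+n]≡2⇒m≡2 n = power-base-byDecision 2 (_≟ 2) {n = n}

m^[1+n]≡3⇒m≡3 : ∀ {m} n → 1 < m → m ^ suc n ≡ 3 → m ≡ 3
m^[1+n]≡3⇒m≡3 n = power-base-byDecision 3 (_≟ 3) {n = n}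

m^[1+n]≡4⇒m≡2∨m≡4 : ∀ {m} n → 1 < m → m ^ suc n ≡ 4 → m ≡ 2 ⊎ m ≡ 4
m^[1+n]≡4⇒m≡2∨m≡4 n = power-base-byDecision 4 (λ m → (m ≟ 2) ⊎-dec (m ≟ 4)) {n = n}

m^[1+n]≡5⇒m≡5 : ∀ {m} n → 1 < m → m ^ suc n ≡ 5 → m ≡ 5
m^[1+n]≡5⇒m≡5 n = power-base-byDecision 5 (_≟ 5) {n = n}

m^n≡2⇒m≡2 : ∀ {m} n → 1 < m → m ^ n ≡ 2 → m ≡ 2
m^n≡2⇒m≡2 (suc n) = m^[1+n]≡2⇒m≡2 n

outcome⇒rescalesExceptional : ∀ {a b c r s ps β q α} y o x → 1 < a → 1 < b → 0 < r → 0 < s →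
  b ^ y ≡ β → b ^ suc o ≡ suc q → a ^ suc x ≡ suc α → Outcome β q α c r s →
  RescalesExceptional (tuple a b c r s ps)
outcome⇒rescalesExceptional {r = r} y o x 1<a 1<b 0<r _ _ b^[1+o]≡ a^[1+x]≡ (five-two refl refl refl c≡ s≡) =
  _ , there (here refl) ,
  inj₁ (multiple⇒rescaling r 0<r (m^[1+n]≡5⇒m≡5 x 1<a a^[1+x]≡) (m^[1+n]≡2⇒m≡2 o 1<b b^[1+o]≡)
                           c≡ (sym (*-identityʳ r)) s≡)
outcome⇒rescalesExceptional {s = s} y o x 1<a 1<b _ 0<s _ b^[1+o]≡ a^[1+x]≡ (three-three refl refl refl c≡ r≡) =
  _ , here refl ,
  inj₁ (multiple⇒rescaling s 0<s (m^[1+n]≡3⇒m≡3 x 1<a a^[1+x]≡) (m^[1+n]≡3⇒m≡3 o 1<b b^[1+o]≡)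
                           c≡ r≡ (sym (*-identityʳ s)))
outcome⇒rescalesExceptional {s = s} y o x 1<a 1<b _ 0<s _ b^[1+o]≡ a^[1+x]≡ (two-five refl refl refl c≡ r≡) =
  _ , there (here refl) ,
  inj₂ (multiple⇒rescaling s 0<s (m^[1+n]≡5⇒m≡5 o 1<b b^[1+o]≡) (m^[1+n]≡2⇒m≡2 x 1<a a^[1+x]≡)
                           c≡ (sym (*-identityʳ s)) r≡)
outcome⇒rescalesExceptional {s = s} y o x 1<a 1<b _ 0<s b^y≡ _ a^[1+x]≡ (four-two refl refl refl c≡ r≡)
  with m^[1+n]≡4⇒m≡2∨m≡4 x 1<a a^[1+x]≡
... | inj₁ a≡2 = _ , there (there (there (here refl))) ,
  inj₁ (multiple⇒rescaling s 0<s a≡2 (m^n≡2⇒m≡2 y 1<b b^y≡) c≡ r≡ (sym (*-identityʳ s)))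
... | inj₂ a≡4 = _ , there (there (there (here refl))) ,
  inj₁ (record { k = 2 ; l = 1 ; m = s ; 0<k = z<s ; 0<l = z<s ; 0<m = 0<s
               ; a≡ = a≡4 ; b≡ = m^n≡2⇒m≡2 y 1<b b^y≡ ; c≡ = c≡ ; r≡ = r≡ ; s≡ = sym (*-identityʳ s) })
outcome⇒rescalesExceptional {s = s} y o x 1<a 1<b _ 0<s b^y≡ _ a^[1+x]≡ (two-four refl refl refl c≡ r≡) =
  _ , there (there (here refl)) ,
  inj₂ (multiple⇒rescaling s 0<s (m^n≡2⇒m≡2 y 1<b b^y≡) (m^[1+n]≡2⇒m≡2 x 1<a a^[1+x]≡)
                           c≡ (sym (*-identityʳ s)) r≡)
outcome⇒rescalesExceptional {s = s} y o x 1<a 1<b _ 0<s b^y≡ _ a^[1+x]≡ (two-two refl refl refl c≡ r≡) =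
  _ , there (there (there (here refl))) ,
  inj₁ (multiple⇒rescaling s 0<s (m^[1+n]≡2⇒m≡2 x 1<a a^[1+x]≡) (m^n≡2⇒m≡2 y 1<b b^y≡)
                           c≡ r≡ (sym (*-identityʳ s)))

module Axes {T : Tuple} (1<a : 1 < a T) (1<b : 1 < b T) (0<c : 0 < c T) (0<r : 0 < r T) (0<s : 0 < s T) where

  private instance
    b≢0 : NonZero (b T)
    b≢0 = >-nonZero (<-trans (s≤s z≤n) 1<b)
    s≢0 : NonZero (s T)
    s≢0 = >-nonZero 0<s

  y-axis : ∀ y → Solution T (0 , y) → SignedSum (c T) (r T) (s T * b T ^ y)
  y-axis _ = subst (λ A → SignedSum (c T) A _) (*-identityʳ (r T))

  x-axis : ∀ x → Solution T (x , 0) → SignedSum (c T) (r T * a T ^ x) (s T)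
  x-axis _ = subst (SignedSum (c T) _) (*-identityʳ (s T))

  s*b^y-≢ : ∀ {y y′} → (0 ,′ y) ≢ (0 ,′ y′) → s T * b T ^ y ≢ s T * b T ^ y′
  s*b^y-≢ ne eq = ne (cong (0 ,_) (^-injectiveʳ 1<b (*-cancelˡ-≡ _ _ (s T) eq)))

  three-on-y-axis : ∀ {y₁ y₂ y₃} → (0 ,′ y₁) ≢ (0 ,′ y₂) → (0 ,′ y₁) ≢ (0 ,′ y₃) → (0 ,′ y₂) ≢ (0 ,′ y₃) →
                    Solution T (0 , y₁) → Solution T (0 , y₂) → Solution T (0 , y₃) → ⊥
  three-on-y-axis {y₁} {y₂} {y₃} ne₁₂ ne₁₃ ne₂₃ sol₁ sol₂ sol₃ =
    no-three-roots (s*b^y-≢ ne₁₂) (s*b^y-≢ ne₁₃) (s*b^y-≢ ne₂₃)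
                   (y-axis y₁ sol₁) (y-axis y₂ sol₂) (y-axis y₃ sol₃)

  high-low-< : ∀ y y′ → s T * b T ^ y′ ≡ c T + r T → SmallRoot (c T) (r T) (s T * b T ^ y) → y < y′
  high-low-< _ _ high low =
    ^-cancelʳ-< (b T) (*-cancelˡ-< (s T) _ _ (<-≤-trans (smallRoot-< 0<c 0<r low) (≤-reflexive (sym high))))

  high-low⇒rescalesExceptional : ∀ x y y′ → s T * b T ^ y′ ≡ c T + r T → SmallRoot (c T) (r T) (s T * b T ^ y) →
                                 SignedSum (c T) (r T * a T ^ suc x) (s T) → RescalesExceptional T
  high-low⇒rescalesExceptional x y y′ high low third
    with m≤n⇒∃[o]m+o≡n (high-low-< y y′ high low) | m^[1+n]≡1+q x 1<a
  ... | o , 1+y+o≡y′ | α , 0<α , a^[1+x]≡1+α with m^[1+n]≡1+q o 1<b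
  ...   | q , 0<q , b^[1+o]≡1+q =
    outcome⇒rescalesExceptional {a T} {b T} {c T} {r T} {s T} {pairs T} y o x 1<a 1<b 0<r 0<s
      refl b^[1+o]≡1+q a^[1+x]≡1+α
      (AxisArithmetic.outcome (m^n>0 (b T) y) 0<q 0<α 0<c 0<r 0<s high′ low
        (subst (λ A → SignedSum (c T) (r T * A) (s T)) a^[1+x]≡1+α third))
    where
    high′ : s T * b T ^ y * suc q ≡ c T + r T
    high′ = begin
      s T * b T ^ y * suc q             ≡⟨ cong (s T * b T ^ y *_) b^[1+o]≡1+q ⟨
      s T * b T ^ y * b T ^ suc o       ≡⟨ *-assoc (s T) (b T ^ y) (b T ^ suc o) ⟩
      s T * (b T ^ y * b T ^ suc o)     ≡⟨ cong (s T *_) (^-distribˡ-+-* (b T) y (suc o)) ⟨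
      s T * b T ^ (y + suc o)           ≡⟨ cong (λ n → s T * b T ^ n) (trans (+-suc y o) 1+y+o≡y′) ⟩
      s T * b T ^ y′                    ≡⟨ high ⟩
      c T + r T                         ∎
      where open ≡-Reasoning

  axes⇒rescalesExceptional : ∀ {x y₁ y₂} → (0 ,′ y₁) ≢ (0 ,′ y₂) → (x ,′ 0) ≢ (0 ,′ y₁) → (x ,′ 0) ≢ (0 ,′ y₂) →
                             Solution T (0 , y₁) → Solution T (0 , y₂) → Solution T (x , 0) → RescalesExceptional T
  axes⇒rescalesExceptional {zero} ne₁₂ ne₃₁ ne₃₂ sol₁ sol₂ sol₃ =
    ⊥-elim (three-on-y-axis ne₁₂ (≢-sym ne₃₁) (≢-sym ne₃₂) sol₁ sol₂ sol₃)
  axes⇒rescalesExceptional {suc x} {y₁} {y₂} ne₁₂ _ _ sol₁ sol₂ sol₃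
    with two-roots (s*b^y-≢ ne₁₂) (y-axis y₁ sol₁) (y-axis y₂ sol₂)
  ... | inj₁ (high , low) = high-low⇒rescalesExceptional x y₂ y₁ high low (x-axis (suc x) sol₃)
  ... | inj₂ (high , low) = high-low⇒rescalesExceptional x y₁ y₂ high low (x-axis (suc x) sol₃)

module Classification {T : Tuple} (1<a : 1 < a T) (1<b : 1 < b T) (0<c : 0 < c T) (0<r : 0 < r T) (0<s : 0 < s T)
  where
  open Axes {T} 1<a 1<b 0<c 0<r 0<s
  private module Swapped = Axes {associate T} 1<b 1<a 0<c 0<s 0<r

  swap-≢ : ∀ {p q : ℕ × ℕ} → p ≢ q → swap p ≢ swap q
  swap-≢ p≢q eq = p≢q (cong swap eq)

  three-on-axes⇒rescalesExceptional : ∀ {p₁ p₂ p₃} → p₁ ≢ p₂ → p₁ ≢ p₃ → p₂ ≢ p₃ →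
    OnAxis p₁ → OnAxis p₂ → OnAxis p₃ → Solution T p₁ → Solution T p₂ → Solution T p₃ → RescalesExceptional T
  three-on-axes⇒rescalesExceptional n₁₂ n₁₃ n₂₃ (inj₁ refl) (inj₁ refl) (inj₁ refl) s₁ s₂ s₃ =
    ⊥-elim (three-on-y-axis n₁₂ n₁₃ n₂₃ s₁ s₂ s₃)
  three-on-axes⇒rescalesExceptional n₁₂ n₁₃ n₂₃ (inj₁ refl) (inj₁ refl) (inj₂ refl) s₁ s₂ s₃ =
    axes⇒rescalesExceptional n₁₂ (≢-sym n₁₃) (≢-sym n₂₃) s₁ s₂ s₃
  three-on-axes⇒rescalesExceptional n₁₂ n₁₃ n₂₃ (inj₁ refl) (inj₂ refl) (inj₁ refl) s₁ s₂ s₃ =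
    axes⇒rescalesExceptional n₁₃ (≢-sym n₁₂) n₂₃ s₁ s₃ s₂
  three-on-axes⇒rescalesExceptional n₁₂ n₁₃ n₂₃ (inj₂ refl) (inj₁ refl) (inj₁ refl) s₁ s₂ s₃ =
    axes⇒rescalesExceptional n₂₃ n₁₂ n₁₃ s₂ s₃ s₁
  three-on-axes⇒rescalesExceptional n₁₂ n₁₃ n₂₃ (inj₂ refl) (inj₂ refl) (inj₂ refl) s₁ s₂ s₃ =
    ⊥-elim (Swapped.three-on-y-axis (swap-≢ n₁₂) (swap-≢ n₁₃) (swap-≢ n₂₃)
                                    (signedSum-comm s₁) (signedSum-comm s₂) (signedSum-comm s₃))
  three-on-axes⇒rescalesExceptional n₁₂ n₁₃ n₂₃ (inj₂ refl) (inj₂ refl) (inj₁ refl) s₁ s₂ s₃ =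
    rescalesExceptional-associate {T}
      (Swapped.axes⇒rescalesExceptional (swap-≢ n₁₂) (swap-≢ (≢-sym n₁₃)) (swap-≢ (≢-sym n₂₃))
                                        (signedSum-comm s₁) (signedSum-comm s₂) (signedSum-comm s₃))
  three-on-axes⇒rescalesExceptional n₁₂ n₁₃ n₂₃ (inj₂ refl) (inj₁ refl) (inj₂ refl) s₁ s₂ s₃ =
    rescalesExceptional-associate {T}
      (Swapped.axes⇒rescalesExceptional (swap-≢ n₁₃) (swap-≢ (≢-sym n₁₂)) (swap-≢ n₂₃)
                                        (signedSum-comm s₁) (signedSum-comm s₃) (signedSum-comm s₂))
  three-on-axes⇒rescalesExceptional n₁₂ n₁₃ n₂₃ (inj₁ refl) (inj₂ refl) (inj₂ refl) s₁ s₂ s₃ =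
    rescalesExceptional-associate {T}
      (Swapped.axes⇒rescalesExceptional (swap-≢ n₂₃) (swap-≢ n₁₂) (swap-≢ n₁₃)
                                        (signedSum-comm s₂) (signedSum-comm s₃) (signedSum-comm s₁))

-- The solutions of the exceptional equations

ListsAllSolutions : Tuple → Set
ListsAllSolutions E = ∀ x y → Solution E (x , y) → (x , y) ∈ pairs E

listed? : ∀ E x y → Dec (Solution E (x , y) → (x , y) ∈ pairs E)
listed? E x y = signedSum? (c E) (r E * a E ^ x) (s E * b E ^ y) →-dec ((x , y) ∈? pairs E)

listsAllSolutions-byDecision : ∀ E K L → (∀ x y → Solution E (x , y) → x < K × y < L) →
  {True (allUpTo? (λ x → allUpTo? (listed? E x) L) K)} → ListsAllSolutions E
listsAllSolutions-byDecision E K L bounded {found} x y sol =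
  allUpTo-byDecision _ K {found} (proj₁ (bounded x y sol)) (proj₂ (bounded x y sol)) sol

-- A common divisor of the bases that does not divide c forces x = 0 or y = 0 in a difference.
difference-bounded : ∀ {a b c r s d x y} → 1 < a → 1 < b → 0 < r → 0 < s → d ∣ a → d ∣ b → ¬ d ∣ c →
                     s * b ^ y ≡ c + r * a ^ x → x ≤ c + s × y ≤ c + r
difference-bounded {c = c} {r} {s} {x = zero} {y} _ 1<b _ 0<s _ _ _ eq =
  z≤n , ≤-trans (n≤m*k^n y 0<s 1<b) (≤-reflexive (trans eq (cong (c +_) (*-identityʳ r))))
difference-bounded {a = a} {c = c} {r} {s} {x = suc x} {zero} 1<a _ 0<r _ _ _ _ eq =
  ≤-trans (n≤m*k^n (suc x) 0<r 1<a) (≤-trans (m≤n+m _ c) (≤-trans (≤-reflexive (trans (sym eq) (*-identityʳ s)))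
                                                                     (m≤n+m s c)))
  , z≤n
difference-bounded {a = a} {b} {c} {r} {s} {d} {suc x} {suc y} _ _ _ _ d∣a d∣b d∤c eq =
  contradiction (∣m+n∣m⇒∣n (subst (d ∣_) (trans eq (+-comm c _)) (∣n⇒∣m*n s (∣m⇒∣m*n (b ^ y) d∣b)))
                           (∣n⇒∣m*n r (∣m⇒∣m*n (a ^ x) d∣a))) d∤c

signedSum-bounded : ∀ {a b c r s d x y} → 1 < a → 1 < b → 0 < r → 0 < s → d ∣ a → d ∣ b → ¬ d ∣ c →
                    SignedSum c (r * a ^ x) (s * b ^ y) → x ≤ c + s × y ≤ c + r
signedSum-bounded 1<a 1<b 0<r 0<s d∣a d∣b d∤c (inj₁ B≡c+A) =
  difference-bounded 1<a 1<b 0<r 0<s d∣a d∣b d∤c B≡c+A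
signedSum-bounded {c = c} {r} {s} {x = x} {y} 1<a 1<b 0<r 0<s _ _ _ (inj₂ (inj₁ A+B≡c)) =
  ≤-trans (n≤m*k^n x 0<r 1<a) (≤-trans (m≤m+n _ _) (≤-trans (≤-reflexive A+B≡c) (m≤m+n c s))) ,
  ≤-trans (n≤m*k^n y 0<s 1<b) (≤-trans (m≤n+m _ _) (≤-trans (≤-reflexive A+B≡c) (m≤m+n c r)))
signedSum-bounded 1<a 1<b 0<r 0<s d∣a d∣b d∤c (inj₂ (inj₂ A≡c+B)) =
  Product.swap (difference-bounded 1<b 1<a 0<s 0<r d∣b d∣a d∤c A≡c+B)

listsAllSolutions-byCommonDivisor : ∀ E d → 1 < a E → 1 < b E → 0 < r E → 0 < s E → d ∣ a E → d ∣ b E → ¬ d ∣ c E →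
  {True (allUpTo? (λ x → allUpTo? (listed? E x) (suc (c E + r E))) (suc (c E + s E)))} → ListsAllSolutions E
listsAllSolutions-byCommonDivisor E d 1<a 1<b 0<r 0<s d∣a d∣b d∤c {found} =
  listsAllSolutions-byDecision E _ _ (λ x y sol → let (x≤ , y≤) = signedSum-bounded 1<a 1<b 0<r 0<s d∣a d∣b d∤c sol
                                                 in s≤s x≤ , s≤s y≤) {found}

E₂-bounded : ∀ x y → SignedSum 3 (1 * 5 ^ x) (2 * 2 ^ y) → x < 6 × y < 7
E₂-bounded x y (inj₁ B≡3+A) with y ≤? 6
... | yes y≤6 = <-trans (^-cancelʳ-< 5 (≤-<-trans 5^x≤128 (m<m+n 128 {497} z<s))) (m<m+n 4 {2} z<s) , s≤s y≤6
  where
  5^x≤128 : 5 ^ x ≤ 128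
  5^x≤128 = begin
    5 ^ x             ≡⟨ *-identityˡ (5 ^ x) ⟨
    1 * 5 ^ x         ≤⟨ m≤n+m (1 * 5 ^ x) 3 ⟩
    3 + 1 * 5 ^ x     ≡⟨ B≡3+A ⟨
    2 * 2 ^ y         ≤⟨ *-monoʳ-≤ 2 (^-monoʳ-≤ 2 y≤6) ⟩
    128               ∎
    where open ≤-Reasoning
... | no  y≰6 with m≤n⇒∃[o]m+o≡n (≰⇒> y≰6)
...   | j , refl = ⊥-elim (256*2^n≢3+5^m j x (begin
  256 * 2 ^ j       ≡⟨ ^-distribˡ-+-* 2 8 j ⟨
  2 * 2 ^ (7 + j)   ≡⟨ B≡3+A ⟩
  3 + 1 * 5 ^ x     ≡⟨ cong (3 +_) (*-identityˡ (5 ^ x)) ⟩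
  3 + 5 ^ x         ∎))
  where open ≡-Reasoning
E₂-bounded x y (inj₂ (inj₁ A+B≡3)) =
  s≤s (≤-trans (n≤m*k^n {1} {5} x z<s (s<s z<s))
               (≤-trans (m≤m+n (1 * 5 ^ x) (2 * 2 ^ y)) (≤-trans (≤-reflexive A+B≡3) (m≤m+n 3 2)))) ,
  s≤s (≤-trans (n≤m*k^n {2} {2} y z<s (s<s z<s))
               (≤-trans (m≤n+m (2 * 2 ^ y) (1 * 5 ^ x)) (≤-trans (≤-reflexive A+B≡3) (m≤m+n 3 3))))
E₂-bounded x zero (inj₂ (inj₂ A≡3+B)) =
  s≤s (≤-trans (n≤m*k^n {1} {5} x z<s (s<s z<s)) (≤-reflexive A≡3+B)) , s≤s z≤n
E₂-bounded x (suc y) (inj₂ (inj₂ A≡3+B)) = ⊥-elim (5^x≢3+4*2^y x y A≡3+B)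

exceptional-listsAllSolutions : All ListsAllSolutions exceptional
exceptional-listsAllSolutions =
    listsAllSolutions-byCommonDivisor (tuple 3 3 2 1 1 _) 3 (s<s z<s) (s<s z<s) z<s z<s ∣-refl ∣-refl (from-no (3 ∣? 2))
  ∷ listsAllSolutions-byDecision (tuple 5 2 3 1 2 _) 6 7 E₂-bounded
  ∷ listsAllSolutions-byCommonDivisor (tuple 2 2 5 1 3 _) 2 (s<s z<s) (s<s z<s) z<s z<s ∣-refl ∣-refl (from-no (2 ∣? 5))
  ∷ listsAllSolutions-byCommonDivisor (tuple 2 2 3 1 1 _) 2 (s<s z<s) (s<s z<s) z<s z<s ∣-refl ∣-refl (from-no (2 ∣? 3))
  ∷ []

exceptional-setsOfSolutions : All IsSetOfSolutions exceptional
exceptional-setsOfSolutions =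
    (s<s z<s , s<s z<s , z<s , z<s , z<s , distinct , s<s (s<s z<s) ,
     (0 , 0 , z≤n , z≤n , refl) ∷ (1 , 0 , 1≤1 , z≤n , refl) ∷ (0 , 1 , z≤n , 1≤1 , refl) ∷ [])
  ∷ (s<s z<s , s<s z<s , z<s , z<s , z<s , distinct , s<s (s<s z<s) ,
     (0 , 0 , z≤n , z≤n , refl) ∷ (1 , 0 , 1≤1 , z≤n , refl) ∷ (0 , 1 , z≤n , 1≤1 , refl) ∷
     (1 , 0 , 1≤1 , z≤n , refl) ∷ (1 , 0 , 1≤1 , z≤n , refl) ∷ [])
  ∷ (s<s z<s , s<s z<s , z<s , z<s , z<s , distinct , s<s (s<s z<s) ,
     (1 , 0 , 1≤1 , z≤n , refl) ∷ (0 , 0 , z≤n , z≤n , refl) ∷ (0 , 1 , z≤n , 1≤1 , refl) ∷ [])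
  ∷ (s<s z<s , s<s z<s , z<s , z<s , z<s , distinct , s<s (s<s z<s) ,
     (0 , 0 , z≤n , z≤n , refl) ∷ (1 , 0 , 1≤1 , z≤n , refl) ∷ (0 , 0 , z≤n , z≤n , refl) ∷
     (0 , 1 , z≤n , 1≤1 , refl) ∷ [])
  ∷ []
  where
  distinct : ∀ {l : List (ℕ × ℕ)} → {True (unique? l)} → Unique l
  distinct {l} {found} = toWitness found
  1≤1 : 1 ≤ 1
  1≤1 = s≤s z≤n

-- Families and associates

ℕ→ℚ≡mkℚ : ∀ n → ℕ→ℚ n ≡ mkℚ (ℤ.+ n) 0 (coprime-sym (1-coprimeTo n))
ℕ→ℚ≡mkℚ n = ℚ.normalize-coprime (coprime-sym (1-coprimeTo n))

ℕ→ℚ-homo-* : ∀ m n → ℕ→ℚ (m * n) ≡ ℕ→ℚ m ℚ.* ℕ→ℚ n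
ℕ→ℚ-homo-* m n = ℚ.toℚᵘ-injective (begin
  ℚ.toℚᵘ (ℕ→ℚ (m * n))                    ≡⟨ cong ℚ.toℚᵘ (ℕ→ℚ≡mkℚ (m * n)) ⟩
  mkℚᵘ (ℤ.+ (m * n)) 0                       ≡⟨ cong (λ i → mkℚᵘ i 0) (ℤ.pos-* m n) ⟩
  mkℚᵘ (ℤ.+ m) 0 ℚᵘ.* mkℚᵘ (ℤ.+ n) 0           ≡⟨ cong₂ ℚᵘ._*_ (cong ℚ.toℚᵘ (ℕ→ℚ≡mkℚ m)) (cong ℚ.toℚᵘ (ℕ→ℚ≡mkℚ n)) ⟨
  ℚ.toℚᵘ (ℕ→ℚ m) ℚᵘ.* ℚ.toℚᵘ (ℕ→ℚ n)      ≈⟨ ℚ.toℚᵘ-homo-* (ℕ→ℚ m) (ℕ→ℚ n) ⟨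
  ℚ.toℚᵘ (ℕ→ℚ m ℚ.* ℕ→ℚ n)                ∎)
  where open ℚᵘ.≃-Reasoning

ℚ[1+_] : ℕ → ℚ
ℚ[1+ m ] = mkℚ (ℤ.+ suc m) 0 (coprime-sym (1-coprimeTo (suc m)))

1/[1+m]*[1+m]*n : ∀ m n → 1/ ℚ[1+ m ] ℚ.* ℕ→ℚ (suc m * n) ≡ ℕ→ℚ n
1/[1+m]*[1+m]*n m n = begin
  1/ ℚ[1+ m ] ℚ.* ℕ→ℚ (suc m * n)                ≡⟨ cong (1/ ℚ[1+ m ] ℚ.*_) (ℕ→ℚ-homo-* (suc m) n) ⟩
  1/ ℚ[1+ m ] ℚ.* (ℕ→ℚ (suc m) ℚ.* ℕ→ℚ n)       ≡⟨ cong (λ q → 1/ ℚ[1+ m ] ℚ.* (q ℚ.* ℕ→ℚ n)) (ℕ→ℚ≡mkℚ (suc m)) ⟩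
  1/ ℚ[1+ m ] ℚ.* (ℚ[1+ m ] ℚ.* ℕ→ℚ n)          ≡⟨ ℚ.*-assoc (1/ ℚ[1+ m ]) ℚ[1+ m ] (ℕ→ℚ n) ⟨
  (1/ ℚ[1+ m ] ℚ.* ℚ[1+ m ]) ℚ.* ℕ→ℚ n          ≡⟨ cong (ℚ._* ℕ→ℚ n) (ℚ.*-inverseˡ ℚ[1+ m ]) ⟩
  ℚ.1ℚ ℚ.* ℕ→ℚ n                                ≡⟨ ℚ.*-identityˡ (ℕ→ℚ n) ⟩
  ℕ→ℚ n                                         ∎
  where open ≡-Reasoning

scale-down : ∀ m {N n} → N ≡ suc m * n → 1/ ℚ[1+ m ] ℚ.* ℕ→ℚ N ≡ ℕ→ℚ n
scale-down m {n = n} refl = 1/[1+m]*[1+m]*n m n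

associate-involutive : ∀ T → associate (associate T) ≡ T
associate-involutive T =
  cong (tuple (a T) (b T) (c T) (r T) (s T)) (trans (sym (map-∘ (pairs T))) (map-id (pairs T)))

swap-injective : ∀ {p q : ℕ × ℕ} → swap p ≡ swap q → p ≡ q
swap-injective = cong swap

isSolutionPair-swap : ∀ {a b c r s} p → IsSolutionPair a b c r s p → IsSolutionPair b a c s r (swap p)
isSolutionPair-swap {a} {b} {c} {r} {s} (x , y) (u , v , u≤1 , v≤1 , eq) =
  v , u , v≤1 , u≤1 , trans (ℤ.+-comm ((-1ℤ ℤ.^ v) ℤ.* ℤ.+ (s * b ^ y)) ((-1ℤ ℤ.^ u) ℤ.* ℤ.+ (r * a ^ x))) eq

setOfSolutions-associate : ∀ {T} → IsSetOfSolutions T → IsSetOfSolutions (associate T)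
setOfSolutions-associate {T} (1<a , 1<b , 0<c , 0<r , 0<s , unique , 2<length , solutions) =
  1<b , 1<a , 0<c , 0<s , 0<r , Unique.map⁺ swap-injective unique ,
  subst (2 <_) (sym (length-map swap (pairs T))) 2<length ,
  All.map⁺ (All.map (λ {p} → isSolutionPair-swap {a T} {b T} {c T} {r T} {s T} p) solutions)

sameFamily-associate : ∀ {X Y} → SameFamily X Y → SameFamily (associate X) (associate Y)
sameFamily-associate {X} {Y} (length≡ , a-powers , b-powers , k , 0<k , k*c≡ , matched) =
  trans (length-map swap (pairs X)) (trans length≡ (sym (length-map swap (pairs Y)))) ,
  b-powers , a-powers , k , 0<k , k*c≡ , matched′
  where
  matched′ : ∀ {p} → p ∈ map swap (pairs X) → ∃ λ q → q ∈ map swap (pairs Y) ×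
               k ℚ.* ℕ→ℚ (s X * b X ^ proj₁ p) ≡ ℕ→ℚ (s Y * b Y ^ proj₁ q) ×
               k ℚ.* ℕ→ℚ (r X * a X ^ proj₂ p) ≡ ℕ→ℚ (r Y * a Y ^ proj₂ q)
  matched′ p∈ with ∈-map⁻ swap p∈
  ... | p₀ , p₀∈ , refl with matched p₀∈
  ...   | q , q∈ , k*ra≡ , k*sb≡ = swap q , ∈-map⁺ swap q∈ , k*sb≡ , k*ra≡

exceptional-associate : ∀ T → IsExceptional (associate T) → IsExceptional T
exceptional-associate T (E , E∈ , U , U⊆E , inj₁ family) =
  E , E∈ , U , U⊆E , inj₂ (subst (λ X → SameFamily X (associate U)) (associate-involutive T)
                                 (sameFamily-associate {associate T} {U} family))
exceptional-associate T (E , E∈ , U , U⊆E , inj₂ family) =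
  E , E∈ , U , U⊆E , inj₁ (subst₂ SameFamily (associate-involutive T) (associate-involutive U)
                                 (sameFamily-associate {associate T} {associate U} family))

rescaled-term : ∀ {R A} m Rₑ Aₑ k x → R ≡ m * Rₑ → A ≡ Aₑ ^ k → R * A ^ x ≡ m * (Rₑ * Aₑ ^ (k * x))
rescaled-term m Rₑ Aₑ k x refl refl = begin
  m * Rₑ * (Aₑ ^ k) ^ x       ≡⟨ *-assoc m Rₑ _ ⟩
  m * (Rₑ * (Aₑ ^ k) ^ x)     ≡⟨ cong (λ n → m * (Rₑ * n)) (^-*-assoc Aₑ k x) ⟩
  m * (Rₑ * Aₑ ^ (k * x))     ∎
  where open ≡-Reasoning

rescaling⇒isExceptional : ∀ {T E} → E ∈ exceptional → IsRescalingOf (a T) (b T) (c T) (r T) (s T) E →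
                          IsSetOfSolutions T → IsExceptional T
rescaling⇒isExceptional {T} {E} E∈ rescaling@record { m = suc m } ST@(_ , _ , _ , _ , _ , uniqueT , 2<lengthT , _) =
  E , E∈ , U , (refl , refl , refl , refl , refl , SU , U⊆E) , inj₁ T∼U
  where
  open IsRescalingOf rescaling hiding (m)
  SE : IsSetOfSolutions E
  SE = All.lookup exceptional-setsOfSolutions E∈
  g : ℕ × ℕ → ℕ × ℕ
  g (x , y) = k * x , l * y
  g-injective : ∀ {p q} → g p ≡ g q → p ≡ q
  g-injective eq = cong₂ _,_ (*-cancelˡ-≡ _ _ k {{>-nonZero 0<k}} (cong proj₁ eq))
                             (*-cancelˡ-≡ _ _ l {{>-nonZero 0<l}} (cong proj₂ eq))
  U : Tuple
  U = tuple (a E) (b E) (c E) (r E) (s E) (map g (pairs T))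
  r-term : ∀ x → r T * a T ^ x ≡ suc m * (r E * a E ^ (k * x))
  r-term x = rescaled-term (suc m) (r E) (a E) k x r≡ a≡
  s-term : ∀ y → s T * b T ^ y ≡ suc m * (s E * b E ^ (l * y))
  s-term y = rescaled-term (suc m) (s E) (b E) l y s≡ b≡
  g-listed : ∀ {p} → p ∈ pairs T → g p ∈ pairs E
  g-listed {x , y} p∈ = All.lookup exceptional-listsAllSolutions E∈ (k * x) (l * y)
    (signedSum-*-cancelˡ {suc m} (signedSum-cong c≡ (r-term x) (s-term y) (setOfSolutions⇒solution ST p∈)))
  U⊆E : ∀ {q} → q ∈ map g (pairs T) → q ∈ pairs E
  U⊆E q∈ with ∈-map⁻ g q∈
  ... | p , p∈ , refl = g-listed p∈
  SU : IsSetOfSolutions U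
  SU = let (1<a , 1<b , 0<c , 0<r , 0<s , _ , _ , solutionsE) = SE in
    1<a , 1<b , 0<c , 0<r , 0<s , Unique.map⁺ g-injective uniqueT ,
    subst (2 <_) (sym (length-map g (pairs T))) 2<lengthT ,
    All.tabulate (λ q∈ → All.lookup solutionsE (U⊆E q∈))
  T∼U : SameFamily T U
  T∼U = sym (length-map g (pairs T)) ,
        (a E , k , 1 , a≡ , sym (*-identityʳ (a E))) ,
        (b E , l , 1 , b≡ , sym (*-identityʳ (b E))) ,
        1/ ℚ[1+ m ] , ℚ.1/pos⇒pos ℚ[1+ m ] , scale-down m c≡ ,
        λ {(x , y)} p∈ → g (x , y) , ∈-map⁺ g p∈ , scale-down m (r-term x) , scale-down m (s-term y)

rescalesExceptional⇒isExceptional : ∀ {T} → IsSetOfSolutions T → RescalesExceptional T → IsExceptional T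
rescalesExceptional⇒isExceptional ST (E , E∈ , inj₁ rescaling) = rescaling⇒isExceptional E∈ rescaling ST
rescalesExceptional⇒isExceptional {T} ST (E , E∈ , inj₂ rescaling) =
  exceptional-associate T (rescaling⇒isExceptional {associate T} E∈ rescaling (setOfSolutions-associate ST))

unique-three : ∀ {A B : Set} {l : List A} → Unique l → 2 < length l →
               (∀ {p₁ p₂ p₃} → p₁ ∈ l → p₂ ∈ l → p₃ ∈ l → p₁ ≢ p₂ → p₁ ≢ p₃ → p₂ ≢ p₃ → B) → B
unique-three {l = []} _ ()
unique-three {l = _ ∷ []} _ (s≤s ())
unique-three {l = _ ∷ _ ∷ []} _ (s≤s (s≤s ()))
unique-three {l = _ ∷ _ ∷ _ ∷ _} ((p₁≢p₂ ∷ p₁≢p₃ ∷ _) ∷ (p₂≢p₃ ∷ _) ∷ _) _ k =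
  k (here refl) (there (here refl)) (there (there (here refl))) p₁≢p₂ p₁≢p₃ p₂≢p₃

min≡0⇒onAxis : ∀ p → proj₁ p ⊓ proj₂ p ≡ 0 → OnAxis p
min≡0⇒onAxis (zero , _) _ = inj₁ refl
min≡0⇒onAxis (suc _ , zero) _ = inj₂ refl

module _ {T : Tuple} (ST : IsSetOfSolutions T) where
  private
    min≡0? : (p : ℕ × ℕ) → Dec (proj₁ p ⊓ proj₂ p ≡ 0)
    min≡0? p = (proj₁ p ⊓ proj₂ p) ≟ 0

    on-axis : ∀ {p} → p ∈ filter min≡0? (pairs T) → OnAxis p
    on-axis {p} p∈ = min≡0⇒onAxis p (proj₂ (∈-filter⁻ min≡0? {xs = pairs T} p∈))

    solution : ∀ {p} → p ∈ filter min≡0? (pairs T) → Solution T p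
    solution p∈ = setOfSolutions⇒solution ST (proj₁ (∈-filter⁻ min≡0? {xs = pairs T} p∈))

  numMinZero>2⇒rescalesExceptional : 2 < numMinZero T → RescalesExceptional T
  numMinZero>2⇒rescalesExceptional 2<numMinZero =
    let (1<a , 1<b , 0<c , 0<r , 0<s , unique , _) = ST in
    unique-three (Unique.filter⁺ min≡0? unique) 2<numMinZero λ p₁∈ p₂∈ p₃∈ ne₁₂ ne₁₃ ne₂₃ →
      Classification.three-on-axes⇒rescalesExceptional {T} 1<a 1<b 0<c 0<r 0<s ne₁₂ ne₁₃ ne₂₃
        (on-axis p₁∈) (on-axis p₂∈) (on-axis p₃∈) (solution p₁∈) (solution p₂∈) (solution p₃∈)

lemma2 : (T : Tuple) → IsSetOfSolutions T → numMinZero T ≤ 2 ⊎ IsExceptional T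
lemma2 T ST with numMinZero T ≤? 2
... | yes ≤2 = inj₁ ≤2
... | no  ≰2 = inj₂ (rescalesExceptional⇒isExceptional ST (numMinZero>2⇒rescalesExceptional ST (≰⇒> ≰2)))
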